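{- Let $\mathcal M\subset\mathbb Z^2$ be a minimal subgraph. Then there is no path $x_0\sim x_1\sim\cdots\sim x_k$ with $k\ge3$ whose vertices all lie in $\delta\mathcal M$, which is a geodesic in $\mathbb Z^2$, and which is isolated in $\mathcal M$, i.e. $\deg_{\mathcal M}(x_j)=2$ for all $1\le j\le k-1$.
   Context: $\mathbb Z^2$ is the integer lattice graph ($x\sim y$ iff $|x-y|=1$). For $\Omega\subset\mathbb Z^2$: $\tau\Omega=\{z\notin\Omega:\exists w\in\Omega,z\sim w\}$, $\overline\Omega=\Omega\cup\tau\Omega$, $E_\Omega$ = edges $\{x,y\}$ with $x\in\Omega,y\in\overline\Omega$, $\partial K$ = edges with exactly one endpoint in $K$, $\delta\Omega=\{x\in\Omega:x\text{ has a neighbor not in }\Omega\}$. A proper nonempty $\mathcal M\subset\mathbb Z^2$ is minimal if for every finite $U$ and every $\hat K\subset\overline U$ with $\hat K\cap\tau U=\mathcal M\cap\tau U$, $|\partial\mathcal M\cap E_U|\le|\partial\hat K\cap E_U|$. $\deg_{\mathcal M}(x)$ is the number of neighbors of $x$ lying in $\mathcal M$. -}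

module Defs where

open import Data.Bool using (Bool; true; false; not; _∧_; _∨_; _xor_; if_then_else_)
open import Data.Nat using (ℕ; zero; suc; _+_; _≤_; _<_)
open import Data.Integer as ℤ using (ℤ; +_)
open import Data.Product using (_×_; _,_; proj₁; proj₂; ∃)
open import Data.Fin using (Fin; zero; suc; inject₁; fromℕ; toℕ)
open import Data.List using (List; []; _∷_)
open import Data.List.Membership.Propositional using (_∈_)
open import Data.List.Relation.Unary.Unique.Propositional using (Unique)
open import Relation.Binary.PropositionalEquality using (_≡_)
open import Relation.Nullary.Decidable using (⌊_⌋)
import Data.Product.Properties as ×P

Pt : Set
Pt = ℤ × ℤ

_≟P_ : (x y : Pt) → Relation.Nullary.Decidable.Dec (x ≡ y)
_≟P_ = ×P.≡-dec ℤ._≟_ ℤ._≟_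

nbrs : Pt → List Pt
nbrs (a , b) = (a ℤ.+ + 1 , b) ∷ (a ℤ.- + 1 , b) ∷ (a , b ℤ.+ + 1) ∷ (a , b ℤ.- + 1) ∷ []

_∼_ : Pt → Pt → Set
x ∼ y = y ∈ nbrs x

Subset : Set
Subset = Pt → Bool

countB : {A : Set} → (A → Bool) → List A → ℕ
countB P [] = zero
countB P (a ∷ as) = if P a then suc (countB P as) else countB P as

anyB : {A : Set} → (A → Bool) → List A → Bool
anyB P [] = false
anyB P (a ∷ as) = P a ∨ anyB P as

inL : Pt → List Pt → Bool
inL z U = anyB (λ w → ⌊ z ≟P w ⌋) U

inTau : List Pt → Pt → Bool
inTau U z = not (inL z U) ∧ anyB (λ w → inL w U) (nbrs z)

inClosure : List Pt → Pt → Bool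
inClosure U z = inL z U ∨ inTau U z

-- strict lexicographic order on points (used only to count each
-- unordered edge with both endpoints in U exactly once)
ltPt : Pt → Pt → Bool
ltPt (a , b) (c , d) = ⌊ a ℤ.<? c ⌋ ∨ (⌊ a ℤ.≟ c ⌋ ∧ ⌊ b ℤ.<? d ⌋)

-- |∂K ∩ E_U| : number of edges {x,y}, x ∈ U, y ∈ closure U, x ∼ y,
-- with exactly one endpoint in K.  Each unordered edge of E_U is
-- enumerated exactly once (for U without duplicates): as (x , y) with
-- x ∈ U, y a neighbour of x, and either y ∉ U or x <lex y.
cutCountAux : Subset → List Pt → List Pt → ℕ
cutCountAux K U [] = zero
cutCountAux K U (x ∷ xs) =
  countB (λ y → (not (inL y U) ∨ ltPt x y) ∧ (K x xor K y)) (nbrs x)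
    + cutCountAux K U xs

cutCount : Subset → List Pt → ℕ
cutCount K U = cutCountAux K U U

Minimal : Subset → Set
Minimal M =
  (∃ λ x → M x ≡ true) × (∃ λ y → M y ≡ false) ×
  ((U : List Pt) → Unique U → (K : Subset) →
     (∀ z → K z ≡ true → inClosure U z ≡ true) →
     (∀ z → inTau U z ≡ true → K z ≡ M z) →
     cutCount M U ≤ cutCount K U)

InBoundary : Subset → Pt → Set
InBoundary M x = M x ≡ true × ∃ λ y → x ∼ y × M y ≡ false

deg : Subset → Pt → ℕ
deg M x = countB M (nbrs x)

IsPath : (k : ℕ) → (Fin (suc k) → Pt) → Set
IsPath k p = (i : Fin k) → p (inject₁ i) ∼ p (suc i)

IsGeodesic : (k : ℕ) → (Fin (suc k) → Pt) → Set
IsGeodesic k p =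
  (m : ℕ) (q : Fin (suc m) → Pt) → IsPath m q →
  q zero ≡ p zero → q (fromℕ m) ≡ p (fromℕ k) → k ≤ m

IsIsolated : Subset → (k : ℕ) → (Fin (suc k) → Pt) → Set
IsIsolated M k p = (j : Fin (suc k)) → 1 ≤ toℕ j → toℕ j < k → deg M (p j) ≡ 2

module Submission where

open import Defs
open import Data.Nat using (ℕ; suc; _≤_)
open import Data.Fin using (Fin)
open import Data.Empty using (⊥)

open import Data.Bool using (Bool; true; false; not; _∧_; _∨_; _xor_)
open import Data.Bool.Properties using (∨-zeroʳ)
open import Data.Empty using (⊥-elim)
open import Data.Fin using (zero; suc)
open import Data.Integer as ℤ using (ℤ; +_)
import Data.Integer.Properties as ℤP
open import Data.List using (List; []; _∷_; length)
open import Data.List.Membership.Propositional using (_∈_; _∉_)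
open import Data.List.Relation.Unary.All using () renaming ([] to []ᴬ; _∷_ to _∷ᴬ_)
open import Data.List.Relation.Unary.AllPairs using () renaming ([] to []ᴾ; _∷_ to _∷ᴾ_)
open import Data.List.Relation.Unary.Any using (here; there)
open import Data.List.Relation.Unary.Unique.Propositional using (Unique)
open import Data.Nat using (_+_; _<_; z≤n; s≤s)
import Data.Nat.Properties as ℕP
open import Data.Product using (_,_; proj₁; proj₂)
open import Function using (_∘_; case_of_)
open import Relation.Binary.PropositionalEquality
open import Relation.Nullary using (yes; no)
open import Relation.Nullary.Decidable using (⌊_⌋)

-- Delete the two interior vertices x₁ ∼ x₂ of the path from M.  Each has
-- two neighbours outside M, which stop being cut edges, and at most one
-- neighbour in M other than its partner, which becomes one: the cut through
-- the edges at {x₁, x₂} drops from at least 4 to at most 2, contradicting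
-- minimality.

∧-true⇒ˡ : ∀ {a b} → a ∧ b ≡ true → a ≡ true
∧-true⇒ˡ {true} _ = refl

∧-true⇒ʳ : ∀ {a b} → a ∧ b ≡ true → b ≡ true
∧-true⇒ʳ {true} b≡true = b≡true

+1-1 : (a : ℤ) → a ℤ.+ + 1 ℤ.- + 1 ≡ a
+1-1 a = trans (ℤP.+-assoc a (+ 1) (ℤ.- + 1)) (ℤP.+-identityʳ a)

-1+1 : (a : ℤ) → a ℤ.- + 1 ℤ.+ + 1 ≡ a
-1+1 a = trans (ℤP.+-assoc a (ℤ.- + 1) (+ 1)) (ℤP.+-identityʳ a)

a+1≢a : (a : ℤ) → a ℤ.+ + 1 ≢ a
a+1≢a a a+1≡a = ℤP.i≢suc[i] (sym (trans (ℤP.+-comm (+ 1) a) a+1≡a))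

a-1≢a : (a : ℤ) → a ℤ.- + 1 ≢ a
a-1≢a a a-1≡a = a+1≢a a (trans (cong (ℤ._+ + 1) (sym a-1≡a)) (-1+1 a))

∼-irrefl : ∀ {x y} → x ∼ y → x ≢ y
∼-irrefl {a , b} (here refl) x≡y = a+1≢a a (sym (cong proj₁ x≡y))
∼-irrefl {a , b} (there (here refl)) x≡y = a-1≢a a (sym (cong proj₁ x≡y))
∼-irrefl {a , b} (there (there (here refl))) x≡y = a+1≢a b (sym (cong proj₂ x≡y))
∼-irrefl {a , b} (there (there (there (here refl)))) x≡y = a-1≢a b (sym (cong proj₂ x≡y))

∼-sym : ∀ {x y} → x ∼ y → y ∼ x
∼-sym {a , b} (here refl) = there (here (cong (_, b) (sym (+1-1 a))))
∼-sym {a , b} (there (here refl)) = here (cong (_, b) (sym (-1+1 a)))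
∼-sym {a , b} (there (there (here refl))) = there (there (there (here (cong (a ,_) (sym (+1-1 b))))))
∼-sym {a , b} (there (there (there (here refl)))) = there (there (here (cong (a ,_) (sym (-1+1 b)))))

module _ {A : Set} where

  countB-mono : (f g : A → Bool) (l : List A) →
    (∀ y → y ∈ l → f y ≡ true → g y ≡ true) → countB f l ≤ countB g l
  countB-mono f g [] f⇒g = z≤n
  countB-mono f g (a ∷ l) f⇒g with f a in fa | g a in ga
  ... | true  | true  = s≤s (countB-mono f g l (λ y → f⇒g y ∘ there))
  ... | true  | false with () ← trans (sym (f⇒g a (here refl) fa)) ga
  ... | false | true  = ℕP.m≤n⇒m≤1+n (countB-mono f g l (λ y → f⇒g y ∘ there))
  ... | false | false = countB-mono f g l (λ y → f⇒g y ∘ there)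

  countB-mono-< : (f g : A → Bool) {o : A} {l : List A} →
    (∀ y → y ∈ l → f y ≡ true → g y ≡ true) →
    o ∈ l → f o ≡ false → g o ≡ true → countB f l < countB g l
  countB-mono-< f g {l = a ∷ l} f⇒g (here refl) fo go rewrite fo | go =
    s≤s (countB-mono f g l (λ y → f⇒g y ∘ there))
  countB-mono-< f g {l = a ∷ l} f⇒g (there o∈l) fo go with f a in fa | g a in ga
  ... | true  | true  = s≤s (countB-mono-< f g (λ y → f⇒g y ∘ there) o∈l fo go)
  ... | true  | false with () ← trans (sym (f⇒g a (here refl) fa)) ga
  ... | false | true  = ℕP.m<n⇒m<1+n (countB-mono-< f g (λ y → f⇒g y ∘ there) o∈l fo go)
  ... | false | false = countB-mono-< f g (λ y → f⇒g y ∘ there) o∈l fo go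

  countB-not+countB : (P : A → Bool) (l : List A) →
    countB (λ y → not (P y)) l + countB P l ≡ length l
  countB-not+countB P [] = refl
  countB-not+countB P (a ∷ l) with P a
  ... | true  = trans (ℕP.+-suc _ _) (cong suc (countB-not+countB P l))
  ... | false = cong suc (countB-not+countB P l)

inL-∈ : ∀ {z U} → z ∈ U → inL z U ≡ true
inL-∈ {z} (here refl) with z ≟P z
... | yes _ = refl
... | no z≢z = ⊥-elim (z≢z refl)
inL-∈ {z} {w ∷ U} (there z∈U) rewrite inL-∈ z∈U = ∨-zeroʳ ⌊ z ≟P w ⌋

inL-∉ : ∀ {z U} → z ∉ U → inL z U ≡ false
inL-∉ {U = []} z∉U = refl
inL-∉ {z} {w ∷ U} z∉U with z ≟P w
... | yes refl = ⊥-elim (z∉U (here refl))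
... | no _ = inL-∉ (z∉U ∘ there)

-- cutCount K U unfolds definitionally to the sum of cutAt K U x over x ∈ U.
cutAt : Subset → List Pt → Pt → ℕ
cutAt K U x = countB (λ y → (not (inL y U) ∨ ltPt x y) ∧ (K x xor K y)) (nbrs x)

outDeg≤cutAt : (K : Subset) (U : List Pt) {x : Pt} → K x ≡ true →
  (∀ y → x ∼ y → K y ≡ false → inL y U ≡ false) →
  countB (λ y → not (K y)) (nbrs x) ≤ cutAt K U x
outDeg≤cutAt K U {x} Kx outside⇒∉U =
  countB-mono _ _ (nbrs x) out⇒cut
  where
  out⇒cut : ∀ y → x ∼ y → not (K y) ≡ true → (not (inL y U) ∨ ltPt x y) ∧ (K x xor K y) ≡ true
  out⇒cut y x∼y _ with K y in Ky
  ... | false rewrite outside⇒∉U y x∼y Ky | Kx = refl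

cutAt≤deg : (K : Subset) (U : List Pt) {x : Pt} → K x ≡ false → cutAt K U x ≤ deg K x
cutAt≤deg K U {x} Kx = countB-mono _ K (nbrs x) cut⇒in
  where
  cut⇒in : ∀ y → x ∼ y → (not (inL y U) ∨ ltPt x y) ∧ (K x xor K y) ≡ true → K y ≡ true
  cut⇒in y _ cut rewrite Kx = ∧-true⇒ʳ cut

cutAt-decreases : (M K : Subset) (U : List Pt) {x o : Pt} →
  (∀ y → K y ≡ true → M y ≡ true) →
  M x ≡ true → K x ≡ false → x ∼ o → M o ≡ true → K o ≡ false →
  (∀ y → x ∼ y → M y ≡ false → inL y U ≡ false) →
  deg M x ≤ 2 → cutAt K U x < cutAt M U x
cutAt-decreases M K U {x} K⊆M Mx Kx x∼o Mo Ko outside⇒∉U degM≤2 = begin-strict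
  cutAt K U x                        ≤⟨ cutAt≤deg K U Kx ⟩
  deg K x                            <⟨ countB-mono-< K M (λ y _ → K⊆M y) x∼o Ko Mo ⟩
  deg M x                            ≤⟨ degM≤2 ⟩
  2                                  ≤⟨ ℕP.+-cancelʳ-≤ (deg M x) 2 _ 2+deg≤4 ⟩
  countB (λ y → not (M y)) (nbrs x)  ≤⟨ outDeg≤cutAt M U Mx outside⇒∉U ⟩
  cutAt M U x                        ∎
  where
  open ℕP.≤-Reasoning
  2+deg≤4 : 2 + deg M x ≤ countB (λ y → not (M y)) (nbrs x) + deg M x
  2+deg≤4 = subst (2 + deg M x ≤_) (sym (countB-not+countB M (nbrs x)))
                  (ℕP.+-monoʳ-≤ 2 degM≤2)

-- M ∩ τU rather than M ∖ U, since Minimal only admits competitors inside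
-- the closure of U.
removeInside : Subset → List Pt → Subset
removeInside M U z = inTau U z ∧ M z

removeInside-⊆ : (M : Subset) (U : List Pt) → ∀ z → removeInside M U z ≡ true → M z ≡ true
removeInside-⊆ M U z = ∧-true⇒ʳ

removeInside-∈ : (M : Subset) {U : List Pt} {z : Pt} → z ∈ U → removeInside M U z ≡ false
removeInside-∈ M z∈U rewrite inL-∈ z∈U = refl

minimal⇒cut≤removeInside : (M : Subset) → Minimal M → (U : List Pt) → Unique U →
  cutCount M U ≤ cutCount (removeInside M U) U
minimal⇒cut≤removeInside M (_ , _ , minimal) U unique =
  minimal U unique (removeInside M U) ⊆closure agreesOnτ
  where
  ⊆closure : ∀ z → removeInside M U z ≡ true → inClosure U z ≡ true
  ⊆closure z inK rewrite ∧-true⇒ˡ {inTau U z} inK = ∨-zeroʳ (inL z U)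
  agreesOnτ : ∀ z → inTau U z ≡ true → removeInside M U z ≡ M z
  agreesOnτ z τz rewrite τz = refl

isolatedEdge-cut-decreases : (M : Subset) {x₁ x₂ : Pt} → x₁ ∼ x₂ →
  M x₁ ≡ true → M x₂ ≡ true → deg M x₁ ≤ 2 → deg M x₂ ≤ 2 →
  cutCount (removeInside M (x₁ ∷ x₂ ∷ [])) (x₁ ∷ x₂ ∷ []) < cutCount M (x₁ ∷ x₂ ∷ [])
isolatedEdge-cut-decreases M {x₁} {x₂} x₁∼x₂ Mx₁ Mx₂ deg₁≤2 deg₂≤2 =
  ℕP.+-mono-< (decreasesAt x₁∼x₂ (here refl) (there (here refl)) deg₁≤2)
    (ℕP.+-mono-<-≤ (decreasesAt (∼-sym x₁∼x₂) (there (here refl)) (here refl) deg₂≤2)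
      ℕP.≤-refl)
  where
  U : List Pt
  U = x₁ ∷ x₂ ∷ []
  K : Subset
  K = removeInside M U
  U⊆M : ∀ {y} → y ∈ U → M y ≡ true
  U⊆M (here refl) = Mx₁
  U⊆M (there (here refl)) = Mx₂
  outside⇒∉U : ∀ y → M y ≡ false → inL y U ≡ false
  outside⇒∉U y My = inL-∉ {y} {U} λ y∈U → case trans (sym My) (U⊆M y∈U) of λ ()
  decreasesAt : ∀ {x o} → x ∼ o → x ∈ U → o ∈ U → deg M x ≤ 2 → cutAt K U x < cutAt M U x
  decreasesAt x∼o x∈U o∈U =
    cutAt-decreases M K U (removeInside-⊆ M U) (U⊆M x∈U) (removeInside-∈ M x∈U) x∼o
      (U⊆M o∈U) (removeInside-∈ M o∈U) (λ y _ → outside⇒∉U y)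

lemma3p2 : (M : Subset) → Minimal M →
    (k : ℕ) → 3 ≤ k → (p : Fin (suc k) → Pt) →
    IsPath k p → (∀ j → InBoundary M (p j)) →
    IsGeodesic k p → IsIsolated M k p → ⊥
lemma3p2 M minimal (suc (suc (suc k))) (s≤s (s≤s (s≤s z≤n))) p path boundary _ isolated =
  ℕP.<-irrefl refl (ℕP.<-≤-trans
    (isolatedEdge-cut-decreases M x₁∼x₂ (proj₁ (boundary _)) (proj₁ (boundary _))
      (ℕP.≤-reflexive (isolated (suc zero) (s≤s z≤n) (s≤s (s≤s z≤n))))
      (ℕP.≤-reflexive (isolated (suc (suc zero)) (s≤s z≤n) (s≤s (s≤s (s≤s z≤n))))))
    (minimal⇒cut≤removeInside M minimal (x₁ ∷ x₂ ∷ []) distinct))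
  where
  x₁ x₂ : Pt
  x₁ = p (suc zero)
  x₂ = p (suc (suc zero))
  x₁∼x₂ : x₁ ∼ x₂
  x₁∼x₂ = path (suc zero)
  distinct : Unique (x₁ ∷ x₂ ∷ [])
  distinct = (∼-irrefl x₁∼x₂ ∷ᴬ []ᴬ) ∷ᴾ ([]ᴬ ∷ᴾ []ᴾ)
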